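{- For every integer $n\ge3$, the transitive tournament $\overrightarrow{K_n}$ and its reflexive closure $r(\overrightarrow{K_n})$ are each invariant under some ordered partial Maltsev operation on their vertex set.
   Context: $\overrightarrow{K_n}$ is the digraph with vertex set $\{0,1,\dots,n-1\}$ and arc set $\{(i,j)\mid i<j\}$; its reflexive closure $r(\overrightarrow{K_n})$ adds a loop $(i,i)$ at every vertex, so its arc set is $\{(i,j)\mid i\le j\}$. For a total order $\le$ on a finite set $D$, the ordered partial Maltsev operation $M_{D,\le}$ is the ternary partial operation with $M_{D,\le}(x,y,y)=M_{D,\le}(y,y,x)=x$ whenever $x\le y$, undefined otherwise. A digraph is invariant under a partial operation if, whenever the operation applied coordinatewise to three arcs is defined in both coordinates, the resulting pair is an arc. -}

module Defs where

open import Data.Nat using (ℕ)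
open import Data.Fin using (Fin; _<_; _≤_)
open import Data.Product using (_×_; Σ-syntax)
open import Data.Sum using (_⊎_)
open import Relation.Binary.PropositionalEquality using (_≡_)
open import Relation.Binary.Structures using (IsTotalOrder)

Digraph : Set → Set₁
Digraph D = D → D → Set

TT : (n : ℕ) → Digraph (Fin n)
TT n i j = i < j

rTT : (n : ℕ) → Digraph (Fin n)
rTT n i j = i ≤ j

-- Graph of the ordered partial Maltsev operation M_{D,⊑}:
-- OrdMaltsev _⊑_ x y z w  means  "M(x,y,z) is defined and equals w".
-- M(x,y,y) = x and M(y,y,x) = x whenever x ⊑ y; undefined otherwise.
OrdMaltsev : {D : Set} → (D → D → Set) → D → D → D → D → Set
OrdMaltsev _⊑_ x y z w =
  (x ⊑ y × y ≡ z × w ≡ x) ⊎ (z ⊑ x × x ≡ y × w ≡ z)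

Invariant : {D : Set} → Digraph D → (D → D → D → D → Set) → Set
Invariant {D} E M =
  ∀ {x₁ x₂ y₁ y₂ z₁ z₂ w₁ w₂ : D} →
  E x₁ x₂ → E y₁ y₂ → E z₁ z₂ →
  M x₁ y₁ z₁ w₁ → M x₂ y₂ z₂ w₂ → E w₁ w₂

HasOrdMaltsev : {D : Set} → Digraph D → Set₁
HasOrdMaltsev {D} E =
  Σ[ _⊑_ ∈ (D → D → Set) ] (IsTotalOrder _≡_ _⊑_ × Invariant E (OrdMaltsev _⊑_))

module Submission where

open import Defs
open import Data.Nat using (ℕ; _≤_)
open import Data.Product using (_×_; _,_)
open import Data.Sum using (inj₁; inj₂)
open import Relation.Binary.Definitions using (LeftTrans)
open import Relation.Binary.PropositionalEquality using (refl)
import Data.Fin as Fin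
import Data.Fin.Properties as Fin
import Data.Nat.Properties as ℕ

-- The value of M is always its first or last argument, so the two sides of the
-- image arc are either the ends of one input arc, or an x ⊑ y = z with an arc out of z.
invariant-ordMaltsev : {D : Set} {_⊑_ : D → D → Set} {E : Digraph D} →
                       LeftTrans _⊑_ E → Invariant E (OrdMaltsev _⊑_)
invariant-ordMaltsev _ ex₁x₂ _ _ (inj₁ (_ , refl , refl)) (inj₁ (_ , refl , refl)) = ex₁x₂
invariant-ordMaltsev trans _ _ ez₁z₂ (inj₁ (x₁⊑y₁ , refl , refl)) (inj₂ (_ , refl , refl)) = trans x₁⊑y₁ ez₁z₂
invariant-ordMaltsev trans ex₁x₂ _ _ (inj₂ (z₁⊑x₁ , refl , refl)) (inj₁ (_ , refl , refl)) = trans z₁⊑x₁ ex₁x₂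
invariant-ordMaltsev _ _ _ ez₁z₂ (inj₂ (_ , refl , refl)) (inj₂ (_ , refl , refl)) = ez₁z₂

hasOrdMaltsev-≤ : {n : ℕ} {E : Digraph (Fin.Fin n)} →
                  LeftTrans Fin._≤_ E → HasOrdMaltsev E
hasOrdMaltsev-≤ trans = Fin._≤_ , Fin.≤-isTotalOrder , invariant-ordMaltsev trans

theorem60 : (n : ℕ) → 3 ≤ n → HasOrdMaltsev (TT n) × HasOrdMaltsev (rTT n)
theorem60 n _ = hasOrdMaltsev-≤ ℕ.≤-<-trans , hasOrdMaltsev-≤ Fin.≤-trans
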